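{- Let $(x_n)_{n\ge1}$ be positive integers with $z_1=x_1>1$ and $x_j=z_jx_{j-1}^2$ with integers $z_j>1$ for all $j\ge2$, and let $\varepsilon_j\in\{\pm1\}$ ($j\ge2$). Consider the strong Engel series with signs $S=\frac{1}{x_1}+\sum_{j=2}^\infty\frac{\varepsilon_j}{x_j}$, with partial sums $S_n=\frac1{x_1}+\sum_{j=2}^n\frac{\varepsilon_j}{x_j}$. Let $\Phi_1=[0;x_1]$, $\Phi_2=\varphi_{z_2}^{(-\varepsilon_2)}(\Phi_1)$, $\Phi_{n+1}=\varphi_{z_{n+1}}^{(\varepsilon_{n+1})}(\Phi_n)$ ($n\ge2$), so that $\Phi_n$ is a continued fraction expansion of $S_n$, and let $\ell_n$ be the length of $\Phi_n$. If $x_1>2$, then $\ell_n=3\cdot2^{n-1}-2$ for all $n\ge1$. If $x_1=2$ and $\varepsilon_j=1$ for all $j$, then $\ell_n=5\cdot2^{n-2}$ for $n\ge3$. If $x_1=2$ and $\varepsilon_j=(-1)^{j-1}$ for all $j$, then $\ell_n=5\cdot2^{n-2}-2$ for $n\ge3$.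
   Context: A finite regular continued fraction is $[a_0;a_1,\ldots,a_n]=a_0+1/(a_1+1/(\cdots+1/a_n))$ with $a_0\in\mathbb Z$, $a_i\in\mathbb Z_{>0}$; its length is $n$. For $\mathbf a=(a_1,\ldots,a_n)$, $n\ge1$, let $\mathbf a^R=(a_n,\ldots,a_1)$, $\tilde{\mathbf a}=(a_1,\ldots,a_{n-1},a_n-1,1)$, and $\tilde{\mathbf a}^R$ its reversal. For a positive integer $z$: $\varphi_z^{(+1)}([a_0;\mathbf a])=[a_0;\mathbf a,z-1,\tilde{\mathbf a}^R]$, $\varphi_z^{(-1)}([a_0;\mathbf a])=[a_0;\tilde{\mathbf a},z-1,\mathbf a^R]$. Whenever a zero partial quotient appears it is removed by the concatenation rule $[\ldots,A,0,B,\ldots]=[\ldots,A+B,\ldots]$ (reducing the length by 2); no other rewriting (such as $[\ldots,b,1]=[\ldots,b+1]$) is performed. -}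

module Defs where

open import Data.Nat using (ℕ; zero; suc; _∸_)
open import Data.Integer using (ℤ; +_) renaming (_+_ to _+ℤ_)
open import Data.List using (List; []; _∷_; _++_; reverse; length)
open import Data.Product using (_×_; _,_; proj₂)
open import Data.Sign using (Sign; opposite) renaming (+ to plus; - to minus)

-- A finite regular continued fraction [a₀; a₁, …, aₙ] : the pair (a₀ , (a₁ ∷ … ∷ aₙ ∷ [])).
CF : Set
CF = ℤ × List ℕ

cfLength : CF → ℕ
cfLength c = length (proj₂ c)

-- Removal of zero partial quotients by [… , A , 0 , B , …] = [… , A + B , …],
-- applied left to right.  The accumulator holds the already processed
-- partial quotients a₁,… in reverse order; when it is empty, A is a₀.
removeZeros : ℤ → List ℕ → List ℕ → CF
removeZeros a₀ acc [] = a₀ , reverse acc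
removeZeros a₀ [] (0 ∷ b ∷ rest) = removeZeros (a₀ +ℤ (+ b)) [] rest
removeZeros a₀ (a ∷ acc) (0 ∷ b ∷ rest) = removeZeros a₀ ((a Data.Nat.+ b) ∷ acc) rest
removeZeros a₀ acc (x ∷ rest) = removeZeros a₀ (x ∷ acc) rest

normalize : CF → CF
normalize (a₀ , as) = removeZeros a₀ [] as

-- ã = (a₁, …, aₙ₋₁, aₙ − 1, 1)  (only meaningful for n ≥ 1)
tilde : List ℕ → List ℕ
tilde [] = []
tilde (x ∷ []) = (x ∸ 1) ∷ 1 ∷ []
tilde (x ∷ y ∷ xs) = x ∷ tilde (y ∷ xs)

φ : Sign → ℕ → CF → CF
φ plus  z (a₀ , as) = normalize (a₀ , (as ++ ((z ∸ 1) ∷ reverse (tilde as))))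
φ minus z (a₀ , as) = normalize (a₀ , (tilde as ++ ((z ∸ 1) ∷ reverse as)))

-- Φ z ε n = Φₙ, for n ≥ 1 (Φ₀ is a dummy value).
Φ : (ℕ → ℕ) → (ℕ → Sign) → ℕ → CF
Φ z ε 0 = + 0 , []
Φ z ε 1 = + 0 , (z 1 ∷ [])
Φ z ε 2 = φ (opposite (ε 2)) (z 2) (Φ z ε 1)
Φ z ε (suc (suc (suc n))) = φ (ε (3 Data.Nat.+ n)) (z (3 Data.Nat.+ n)) (Φ z ε (suc (suc n)))

ℓ : (ℕ → ℕ) → (ℕ → Sign) → ℕ → ℕ
ℓ z ε n = cfLength (Φ z ε n)

-- altSign j = (−1)^(j−1)
altSign : ℕ → Sign
altSign 0 = minus
altSign (suc j) = opposite (altSign j)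

module Submission where

-- The map φ_z^{(±1)} glues a
-- list to (z − 1) and to the reversal of its "tilde" (only the last entry is
-- changed by ~).  If the list is FRAMED, i.e. f ∷ m ++ [l] with f, l ≥ 2 and m
-- positive, both gluings produce  f ∷ (m ++ core ++ reverse m) ++ [f]  with a
-- positive four-element core, so no zero partial quotient arises, the result
-- is framed again, and  length + 2  doubles.  If the list is PADDED, i.e.
-- 1 ∷ x ∷ K ++ [w , 1], the sign +1 creates exactly one zero quotient; its
-- removal merges 1 and w, the result is padded again, and the length doubles.
--
-- The three claims of the corollary follow by starting the
-- doubling at Φ₂ (framed, x₁ > 2), Φ₃ (padded, x₁ = 2, all signs +1) or
-- Φ₃ (framed, x₁ = 2, alternating signs); these seeds are computed directly.

open import Defs
open import Data.Nat using (ℕ; _∸_; _*_; _^_; _≤_; _<_)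
open import Data.Product using (_×_)
open import Data.Sign using (Sign)
open import Relation.Binary.PropositionalEquality using (_≡_)

open import Data.Nat using (zero; suc; _+_; z≤n; s≤s)
open import Data.Nat.Properties using (m+n∸n≡m; *-identityˡ; *-assoc)
open import Data.Nat.Tactic.RingSolver using (solve-∀)
open import Data.Integer using (+_)
open import Data.List using (List; []; _∷_; _++_; reverse; length; _ʳ++_)
open import Data.List.Properties
  using (ʳ++-defn; ʳ++-ʳ++; reverse-++; length-++; length-reverse; ++-monoid)
open import Data.List.Relation.Unary.All using (All; []; _∷_)
open import Data.List.Relation.Unary.All.Properties using (++⁺)
open import Data.List.Relation.Binary.Permutation.Propositional using (↭-sym)
open import Data.List.Relation.Binary.Permutation.Propositional.Properties
  using (All-resp-↭; ↭-reverse)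
open import Data.Product using (_,_; proj₂)
open import Data.Sign using (opposite) renaming (+ to plus; - to minus)
open import Relation.Binary.PropositionalEquality
  using (refl; sym; trans; cong; subst; module ≡-Reasoning)
import Algebra.Solver.Monoid as MonoidSolver

open MonoidSolver (++-monoid ℕ) using (solve; _⊜_; _⊕_)

Pos : ℕ → Set
Pos x = 1 ≤ x

≥2⇒positive : ∀ {x} → 2 ≤ x → Pos x
≥2⇒positive (s≤s _) = s≤s z≤n

>1⇒pred-positive : ∀ {x} → 1 < x → Pos (x ∸ 1)
>1⇒pred-positive (s≤s (s≤s _)) = s≤s z≤n

all-reverse : ∀ {xs} → All Pos xs → All Pos (reverse xs)
all-reverse {xs} = All-resp-↭ (↭-sym (↭-reverse xs))

removeZeros-push : ∀ a acc {x} → Pos x → ∀ rest →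
  removeZeros a acc (x ∷ rest) ≡ removeZeros a (x ∷ acc) rest
removeZeros-push a []      (s≤s z≤n) rest = refl
removeZeros-push a (_ ∷ _) (s≤s z≤n) rest = refl

removeZeros-skip : ∀ a acc {xs} → All Pos xs → ∀ ys →
  removeZeros a acc (xs ++ ys) ≡ removeZeros a (xs ʳ++ acc) ys
removeZeros-skip a acc []                 ys = refl
removeZeros-skip a acc {x ∷ _} (px ∷ pxs) ys =
  trans (removeZeros-push a acc px _) (removeZeros-skip a (x ∷ acc) pxs ys)

removeZeros-positive : ∀ a acc {xs} → All Pos xs → removeZeros a acc xs ≡ (a , acc ʳ++ xs)
removeZeros-positive a acc []                 = refl
removeZeros-positive a acc {x ∷ _} (px ∷ pxs) =
  trans (removeZeros-push a acc px _) (removeZeros-positive a (x ∷ acc) pxs)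

normalize-positive : ∀ a {xs} → All Pos xs → normalize (a , xs) ≡ (a , xs)
normalize-positive a = removeZeros-positive a []

normalize-merge : ∀ a {xs c} → All Pos xs → Pos c → ∀ b {r} → All Pos r →
  normalize (a , xs ++ c ∷ 0 ∷ b ∷ r) ≡ (a , xs ++ c + b ∷ r)
normalize-merge a {xs} {c} pxs pc b {r} pr = begin
  removeZeros a [] (xs ++ c ∷ 0 ∷ b ∷ r)          ≡⟨ removeZeros-skip a [] pxs _ ⟩
  removeZeros a (xs ʳ++ []) (c ∷ 0 ∷ b ∷ r)       ≡⟨ removeZeros-push a (xs ʳ++ []) pc (0 ∷ b ∷ r) ⟩
  removeZeros a (c ∷ xs ʳ++ []) (0 ∷ b ∷ r)       ≡⟨⟩
  removeZeros a (c + b ∷ xs ʳ++ []) r             ≡⟨ removeZeros-positive a _ pr ⟩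
  (a , (xs ʳ++ []) ʳ++ (c + b ∷ r))               ≡⟨ cong (a ,_) (ʳ++-ʳ++ xs) ⟩
  (a , xs ++ c + b ∷ r)                           ∎
  where open ≡-Reasoning

glue : Sign → ℕ → List ℕ → List ℕ
glue plus  z as = as ++ (z ∸ 1) ∷ reverse (tilde as)
glue minus z as = tilde as ++ (z ∸ 1) ∷ reverse as

φ-glue : ∀ s z a as → φ s z (a , as) ≡ normalize (a , glue s z as)
φ-glue plus  z a as = refl
φ-glue minus z a as = refl

tilde-++ : ∀ xs y ys → tilde (xs ++ y ∷ ys) ≡ xs ++ tilde (y ∷ ys)
tilde-++ []           y ys = refl
tilde-++ (x ∷ [])     y ys = refl
tilde-++ (x ∷ x′ ∷ xs) y ys = cong (x ∷_) (tilde-++ (x′ ∷ xs) y ys)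

glue-mirror : ∀ f m p y q →
  (f ∷ m ++ p) ++ y ∷ reverse (f ∷ m ++ q) ≡ f ∷ (m ++ (p ++ y ∷ reverse q) ++ reverse m) ++ f ∷ []
glue-mirror f m p y q = begin
  (f ∷ m ++ p) ++ y ∷ reverse (f ∷ m ++ q)
    ≡⟨ cong (λ t → (f ∷ m ++ p) ++ y ∷ t) (reverse-++ (f ∷ m) q) ⟩
  (f ∷ m ++ p) ++ y ∷ reverse q ++ reverse (f ∷ m)
    ≡⟨ cong (λ t → (f ∷ m ++ p) ++ y ∷ reverse q ++ t) (ʳ++-defn m) ⟩
  (f ∷ m ++ p) ++ y ∷ reverse q ++ reverse m ++ f ∷ []
    ≡⟨ solve 6 (λ F Y M P Q R → (F ⊕ M ⊕ P) ⊕ Y ⊕ Q ⊕ R ⊕ F ⊜ F ⊕ (M ⊕ (P ⊕ Y ⊕ Q) ⊕ R) ⊕ F)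
         refl (f ∷ []) (y ∷ []) m p (reverse q) (reverse m) ⟩
  f ∷ (m ++ (p ++ y ∷ reverse q) ++ reverse m) ++ f ∷ []
    ∎
  where open ≡-Reasoning

length-enclosed : ∀ (p xs q : List ℕ) → length (p ++ xs ++ q) ≡ length p + (length xs + length q)
length-enclosed p xs q = trans (length-++ p) (cong (λ t → length p + t) (length-++ xs))

length-palindrome : ∀ (m c : List ℕ) → length (m ++ c ++ reverse m) ≡ length c + 2 * length m
length-palindrome m c = begin
  length (m ++ c ++ reverse m)                 ≡⟨ length-++ m ⟩
  length m + length (c ++ reverse m)           ≡⟨ cong (λ t → length m + t) (length-++ c) ⟩
  length m + (length c + length (reverse m))   ≡⟨ cong (λ t → length m + (length c + t)) (length-reverse m) ⟩
  length m + (length c + length m)             ≡⟨ arith (length m) (length c) ⟩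
  length c + 2 * length m                      ∎
  where
  open ≡-Reasoning
  arith : ∀ x y → x + (y + x) ≡ y + 2 * x
  arith = solve-∀

data Framed : List ℕ → Set where
  framed : ∀ {f l} m → 2 ≤ f → 2 ≤ l → All Pos m → Framed (f ∷ m ++ l ∷ [])

frameCore : Sign → ℕ → ℕ → List ℕ
frameCore plus  z l = l ∷ (z ∸ 1) ∷ 1 ∷ (l ∸ 1) ∷ []
frameCore minus z l = (l ∸ 1) ∷ 1 ∷ (z ∸ 1) ∷ l ∷ []

frameCore-positive : ∀ s {z l} → 1 < z → 2 ≤ l → All Pos (frameCore s z l)
frameCore-positive plus  hz hl = ≥2⇒positive hl ∷ >1⇒pred-positive hz ∷ s≤s z≤n ∷ >1⇒pred-positive hl ∷ []
frameCore-positive minus hz hl = >1⇒pred-positive hl ∷ s≤s z≤n ∷ >1⇒pred-positive hz ∷ ≥2⇒positive hl ∷ []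

frameCore-length : ∀ s z l → length (frameCore s z l) ≡ 4
frameCore-length plus  z l = refl
frameCore-length minus z l = refl

palindrome-positive : ∀ s {z l m} → 1 < z → 2 ≤ l → All Pos m →
  All Pos (m ++ frameCore s z l ++ reverse m)
palindrome-positive s hz hl pm = ++⁺ pm (++⁺ (frameCore-positive s hz hl) (all-reverse pm))

glue-framed : ∀ s z f m l → glue s z (f ∷ m ++ l ∷ []) ≡ f ∷ (m ++ frameCore s z l ++ reverse m) ++ f ∷ []
glue-framed plus z f m l =
  trans (cong (λ t → (f ∷ m ++ l ∷ []) ++ (z ∸ 1) ∷ reverse t) (tilde-++ (f ∷ m) l []))
        (glue-mirror f m (l ∷ []) (z ∸ 1) ((l ∸ 1) ∷ 1 ∷ []))
glue-framed minus z f m l =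
  trans (cong (λ t → t ++ (z ∸ 1) ∷ reverse (f ∷ m ++ l ∷ [])) (tilde-++ (f ∷ m) l []))
        (glue-mirror f m ((l ∸ 1) ∷ 1 ∷ []) (z ∸ 1) (l ∷ []))

φ-framed : ∀ s z a {f m l} → 1 < z → 2 ≤ f → 2 ≤ l → All Pos m →
  φ s z (a , f ∷ m ++ l ∷ []) ≡ (a , f ∷ (m ++ frameCore s z l ++ reverse m) ++ f ∷ [])
φ-framed s z a {f} {m} {l} hz hf hl pm = begin
  φ s z (a , f ∷ m ++ l ∷ [])                               ≡⟨ φ-glue s z a _ ⟩
  normalize (a , glue s z (f ∷ m ++ l ∷ []))                ≡⟨ cong (λ xs → normalize (a , xs)) (glue-framed s z f m l) ⟩
  normalize (a , f ∷ (m ++ frameCore s z l ++ reverse m) ++ f ∷ [])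
    ≡⟨ normalize-positive a (≥2⇒positive hf ∷ ++⁺ (palindrome-positive s hz hl pm) (≥2⇒positive hf ∷ [])) ⟩
  (a , f ∷ (m ++ frameCore s z l ++ reverse m) ++ f ∷ [])   ∎
  where open ≡-Reasoning

framed-step : ∀ s z c → 1 < z → Framed (proj₂ c) →
  Framed (proj₂ (φ s z c)) × cfLength (φ s z c) + 2 ≡ 2 * (cfLength c + 2)
framed-step s z (a , _) hz (framed {f} {l} m hf hl pm)
  rewrite φ-framed s z a hz hf hl pm =
  framed (m ++ frameCore s z l ++ reverse m) hf hf (palindrome-positive s hz hl pm) , doubled
  where
  open ≡-Reasoning
  arith : ∀ k → 1 + ((4 + 2 * k) + 1) + 2 ≡ 2 * (1 + (k + 1) + 2)
  arith = solve-∀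
  doubled : length (f ∷ (m ++ frameCore s z l ++ reverse m) ++ f ∷ []) + 2
          ≡ 2 * (length (f ∷ m ++ l ∷ []) + 2)
  doubled = begin
    length (f ∷ (m ++ frameCore s z l ++ reverse m) ++ f ∷ []) + 2
      ≡⟨ cong (_+ 2) (length-enclosed (f ∷ []) (m ++ frameCore s z l ++ reverse m) (f ∷ [])) ⟩
    1 + (length (m ++ frameCore s z l ++ reverse m) + 1) + 2
      ≡⟨ cong (λ t → 1 + (t + 1) + 2) (length-palindrome m (frameCore s z l)) ⟩
    1 + ((length (frameCore s z l) + 2 * length m) + 1) + 2
      ≡⟨ cong (λ t → 1 + ((t + 2 * length m) + 1) + 2) (frameCore-length s z l) ⟩
    1 + ((4 + 2 * length m) + 1) + 2
      ≡⟨ arith (length m) ⟩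
    2 * (1 + (length m + 1) + 2)
      ≡⟨ cong (λ t → 2 * (t + 2)) (sym (length-enclosed (f ∷ []) m (l ∷ []))) ⟩
    2 * (length (f ∷ m ++ l ∷ []) + 2)
      ∎

data Padded : List ℕ → Set where
  padded : ∀ {x w} K → Pos x → Pos w → All Pos K → Padded (1 ∷ x ∷ K ++ w ∷ 1 ∷ [])

paddedCore : ℕ → ℕ → List ℕ
paddedCore z w = w ∷ 1 ∷ (z ∸ 1) ∷ suc w ∷ []

-- φ^{(+1)} on a padded list: ~ turns the final 1 into 0 , 1, and the
-- resulting zero quotient merges the 1 before it with the reversed w.
φ-padded : ∀ z a {x w K} → 1 < z → Pos x → Pos w → All Pos K →
  φ plus z (a , 1 ∷ x ∷ K ++ w ∷ 1 ∷ []) ≡ (a , 1 ∷ x ∷ (K ++ paddedCore z w ++ reverse K) ++ x ∷ 1 ∷ [])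
φ-padded z a {x} {w} {K} (s≤s (s≤s _)) px pw pK = begin
  normalize (a , as ++ (z ∸ 1) ∷ reverse (tilde as))
    ≡⟨ cong (λ t → normalize (a , as ++ (z ∸ 1) ∷ reverse t)) (tilde-++ (1 ∷ x ∷ K) w (1 ∷ [])) ⟩
  normalize (a , as ++ (z ∸ 1) ∷ reverse ((1 ∷ x ∷ K) ++ w ∷ 0 ∷ 1 ∷ []))
    ≡⟨ cong (λ t → normalize (a , as ++ (z ∸ 1) ∷ t)) (reverse-++ (1 ∷ x ∷ K) (w ∷ 0 ∷ 1 ∷ [])) ⟩
  normalize (a , as ++ (z ∸ 1) ∷ 1 ∷ 0 ∷ w ∷ reverse (1 ∷ x ∷ K))
    ≡⟨ cong (λ t → normalize (a , as ++ (z ∸ 1) ∷ 1 ∷ 0 ∷ w ∷ t)) (ʳ++-defn K) ⟩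
  normalize (a , as ++ (z ∸ 1) ∷ 1 ∷ 0 ∷ w ∷ reverse K ++ x ∷ 1 ∷ [])
    ≡⟨ cong (λ t → normalize (a , t))
         (solve 7 (λ O X W Y N K R → (O ⊕ X ⊕ K ⊕ W ⊕ O) ⊕ Y ⊕ O ⊕ N ⊕ W ⊕ R ⊕ X ⊕ O
                                   ⊜ (O ⊕ X ⊕ K ⊕ W ⊕ O ⊕ Y) ⊕ O ⊕ N ⊕ W ⊕ R ⊕ X ⊕ O)
            refl (1 ∷ []) (x ∷ []) (w ∷ []) ((z ∸ 1) ∷ []) (0 ∷ []) K (reverse K)) ⟩
  normalize (a , (1 ∷ x ∷ K ++ w ∷ 1 ∷ (z ∸ 1) ∷ []) ++ 1 ∷ 0 ∷ w ∷ reverse K ++ x ∷ 1 ∷ [])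
    ≡⟨ normalize-merge a prefix-positive (s≤s z≤n) w (++⁺ (all-reverse pK) (px ∷ s≤s z≤n ∷ [])) ⟩
  (a , (1 ∷ x ∷ K ++ w ∷ 1 ∷ (z ∸ 1) ∷ []) ++ suc w ∷ reverse K ++ x ∷ 1 ∷ [])
    ≡⟨ cong (a ,_)
         (solve 7 (λ O X W Y S K R → (O ⊕ X ⊕ K ⊕ W ⊕ O ⊕ Y) ⊕ S ⊕ R ⊕ X ⊕ O
                                   ⊜ O ⊕ X ⊕ (K ⊕ (W ⊕ O ⊕ Y ⊕ S) ⊕ R) ⊕ X ⊕ O)
            refl (1 ∷ []) (x ∷ []) (w ∷ []) ((z ∸ 1) ∷ []) (suc w ∷ []) K (reverse K)) ⟩
  (a , 1 ∷ x ∷ (K ++ paddedCore z w ++ reverse K) ++ x ∷ 1 ∷ [])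
    ∎
  where
  open ≡-Reasoning
  as : List ℕ
  as = 1 ∷ x ∷ K ++ w ∷ 1 ∷ []
  prefix-positive : All Pos (1 ∷ x ∷ K ++ w ∷ 1 ∷ (z ∸ 1) ∷ [])
  prefix-positive = s≤s z≤n ∷ px ∷ ++⁺ pK (pw ∷ s≤s z≤n ∷ s≤s z≤n ∷ [])

padded-step : ∀ {s} z c → s ≡ plus → 1 < z → Padded (proj₂ c) →
  Padded (proj₂ (φ s z c)) × cfLength (φ s z c) ≡ 2 * cfLength c
padded-step z (a , _) refl hz (padded {x} {w} K px pw pK)
  rewrite φ-padded z a hz px pw pK =
  padded (K ++ paddedCore z w ++ reverse K) px px (++⁺ pK (++⁺ core-positive (all-reverse pK))) , doubled
  where
  open ≡-Reasoning
  core-positive : All Pos (paddedCore z w)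
  core-positive = pw ∷ s≤s z≤n ∷ >1⇒pred-positive hz ∷ s≤s z≤n ∷ []
  arith : ∀ k → 2 + ((4 + 2 * k) + 2) ≡ 2 * (2 + (k + 2))
  arith = solve-∀
  doubled : length (1 ∷ x ∷ (K ++ paddedCore z w ++ reverse K) ++ x ∷ 1 ∷ [])
          ≡ 2 * length (1 ∷ x ∷ K ++ w ∷ 1 ∷ [])
  doubled = begin
    length (1 ∷ x ∷ (K ++ paddedCore z w ++ reverse K) ++ x ∷ 1 ∷ [])
      ≡⟨ length-enclosed (1 ∷ x ∷ []) (K ++ paddedCore z w ++ reverse K) (x ∷ 1 ∷ []) ⟩
    2 + (length (K ++ paddedCore z w ++ reverse K) + 2)
      ≡⟨ cong (λ t → 2 + (t + 2)) (length-palindrome K (paddedCore z w)) ⟩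
    2 + ((4 + 2 * length K) + 2)
      ≡⟨ arith (length K) ⟩
    2 * (2 + (length K + 2))
      ≡⟨ cong (2 *_) (sym (length-enclosed (1 ∷ x ∷ []) K (w ∷ 1 ∷ []))) ⟩
    2 * length (1 ∷ x ∷ K ++ w ∷ 1 ∷ [])
      ∎

doubling : ∀ {A : Set} (G : ℕ → A) (Inv : A → Set) (size : A → ℕ) {c} →
  (∀ k → Inv (G k) → Inv (G (suc k)) × size (G (suc k)) ≡ 2 * size (G k)) →
  Inv (G 0) × size (G 0) ≡ c → ∀ k → Inv (G k) × size (G k) ≡ 2 ^ k * c
doubling G Inv size {c} step (inv₀ , eq₀) zero = inv₀ , trans eq₀ (sym (*-identityˡ c))
doubling G Inv size {c} step start (suc k) =
  let (inv , eq) = doubling G Inv size step start k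
      (inv′ , eq′) = step k inv
  in inv′ , trans eq′ (trans (cong (2 *_) eq) (sym (*-assoc 2 (2 ^ k) c)))

seed-Φ₂ : ∀ s a {x₁ x₂} → 2 < x₁ → 1 < x₂ →
  Framed (proj₂ (φ s x₂ (a , x₁ ∷ []))) × cfLength (φ s x₂ (a , x₁ ∷ [])) + 2 ≡ 6
seed-Φ₂ plus  a {x₂ = suc (suc j)} (s≤s (s≤s (s≤s _))) (s≤s (s≤s _)) =
  framed (suc j ∷ 1 ∷ []) (s≤s (s≤s z≤n)) (s≤s (s≤s z≤n)) (s≤s z≤n ∷ s≤s z≤n ∷ []) , refl
seed-Φ₂ minus a {x₂ = suc (suc j)} (s≤s (s≤s (s≤s _))) (s≤s (s≤s _)) =
  framed (1 ∷ suc j ∷ []) (s≤s (s≤s z≤n)) (s≤s (s≤s z≤n)) (s≤s z≤n ∷ s≤s z≤n ∷ []) , refl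

seed-Φ₃-padded : ∀ a {x₂ x₃} → 1 < x₂ → 1 < x₃ →
  Padded (proj₂ (φ plus x₃ (φ minus x₂ (a , 2 ∷ []))))
  × cfLength (φ plus x₃ (φ minus x₂ (a , 2 ∷ []))) ≡ 10
seed-Φ₃-padded a {suc (suc i)} {suc (suc j)} (s≤s (s≤s _)) (s≤s (s≤s _)) =
  padded (suc i ∷ 2 ∷ suc j ∷ 1 ∷ 1 ∷ suc i ∷ []) (s≤s z≤n) (s≤s z≤n)
    (s≤s z≤n ∷ s≤s z≤n ∷ s≤s z≤n ∷ s≤s z≤n ∷ s≤s z≤n ∷ s≤s z≤n ∷ []) , refl

seed-Φ₃-framed : ∀ a {x₂ x₃} → 1 < x₂ → 1 < x₃ →
  Framed (proj₂ (φ plus x₃ (φ plus x₂ (a , 2 ∷ []))))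
  × cfLength (φ plus x₃ (φ plus x₂ (a , 2 ∷ []))) + 2 ≡ 10
seed-Φ₃-framed a {suc (suc i)} {suc (suc j)} (s≤s (s≤s _)) (s≤s (s≤s _)) =
  framed (suc i ∷ 1 ∷ 1 ∷ suc j ∷ 2 ∷ suc i ∷ []) (s≤s (s≤s z≤n)) (s≤s (s≤s z≤n))
    (s≤s z≤n ∷ s≤s z≤n ∷ s≤s z≤n ∷ s≤s z≤n ∷ s≤s z≤n ∷ s≤s z≤n ∷ []) , refl

Φ₃-unfold : ∀ z ε {x₁ s₂ s₃} → z 1 ≡ x₁ → opposite (ε 2) ≡ s₂ → ε 3 ≡ s₃ →
  Φ z ε 3 ≡ φ s₃ (z 3) (φ s₂ (z 2) (+ 0 , x₁ ∷ []))
Φ₃-unfold z ε refl refl refl = refl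

+2⇒∸2 : ∀ {n m} → n + 2 ≡ m → n ≡ m ∸ 2
+2⇒∸2 {n} eq = trans (sym (m+n∸n≡m n 2)) (cong (_∸ 2) eq)

-- Standing data: the quotients zⱼ > 1 (z₁ = x₁) and the signs εⱼ.
module _ (z : ℕ → ℕ) (ε : ℕ → Sign) (hz : ∀ j → 1 ≤ j → 1 < z j) where

  framed-from-Φ₂ : 2 < z 1 → ∀ k →
    Framed (proj₂ (Φ z ε (2 + k))) × ℓ z ε (2 + k) + 2 ≡ 2 ^ k * 6
  framed-from-Φ₂ h₁ =
    doubling (λ k → Φ z ε (2 + k)) (λ c → Framed (proj₂ c)) (λ c → cfLength c + 2)
      (λ k → framed-step (ε (3 + k)) (z (3 + k)) (Φ z ε (2 + k)) (hz (3 + k) (s≤s z≤n)))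
      (seed-Φ₂ (opposite (ε 2)) (+ 0) h₁ (hz 2 (s≤s z≤n)))

  -- ℓₙ = 3·2^(n−1) − 2, since ℓ₁ = 1 and ℓₙ + 2 = 6·2^(n−2) for n ≥ 2.
  lengths-x₁>2 : 2 < z 1 → ∀ n → 1 ≤ n → ℓ z ε n ≡ 3 * 2 ^ (n ∸ 1) ∸ 2
  lengths-x₁>2 h₁ (suc zero)    _ = refl
  lengths-x₁>2 h₁ (suc (suc k)) _ =
    +2⇒∸2 (trans (proj₂ (framed-from-Φ₂ h₁ k)) (arith (2 ^ k)))
    where
    arith : ∀ y → y * 6 ≡ 3 * (2 * y)
    arith = solve-∀

  padded-from-Φ₃ : z 1 ≡ 2 → (∀ j → 2 ≤ j → ε j ≡ plus) → ∀ k →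
    Padded (proj₂ (Φ z ε (3 + k))) × ℓ z ε (3 + k) ≡ 2 ^ k * 10
  padded-from-Φ₃ h₁ hε =
    doubling (λ k → Φ z ε (3 + k)) (λ c → Padded (proj₂ c)) cfLength
      (λ k → padded-step (z (4 + k)) (Φ z ε (3 + k)) (hε (4 + k) (s≤s (s≤s z≤n))) (hz (4 + k) (s≤s z≤n)))
      (subst (λ c → Padded (proj₂ c) × cfLength c ≡ 10)
        (sym (Φ₃-unfold z ε h₁ (cong opposite (hε 2 (s≤s (s≤s z≤n)))) (hε 3 (s≤s (s≤s z≤n)))))
        (seed-Φ₃-padded (+ 0) (hz 2 (s≤s z≤n)) (hz 3 (s≤s z≤n))))

  lengths-all-plus : z 1 ≡ 2 → (∀ j → 2 ≤ j → ε j ≡ plus) → ∀ n → 3 ≤ n → ℓ z ε n ≡ 5 * 2 ^ (n ∸ 2)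
  lengths-all-plus h₁ hε 1 (s≤s ())
  lengths-all-plus h₁ hε 2 (s≤s (s≤s ()))
  lengths-all-plus h₁ hε (suc (suc (suc k))) _ =
    trans (proj₂ (padded-from-Φ₃ h₁ hε k)) (arith (2 ^ k))
    where
    arith : ∀ y → y * 10 ≡ 5 * (2 * y)
    arith = solve-∀

  framed-from-Φ₃ : z 1 ≡ 2 → (∀ j → 2 ≤ j → ε j ≡ altSign j) → ∀ k →
    Framed (proj₂ (Φ z ε (3 + k))) × ℓ z ε (3 + k) + 2 ≡ 2 ^ k * 10
  framed-from-Φ₃ h₁ hε =
    doubling (λ k → Φ z ε (3 + k)) (λ c → Framed (proj₂ c)) (λ c → cfLength c + 2)
      (λ k → framed-step (ε (4 + k)) (z (4 + k)) (Φ z ε (3 + k)) (hz (4 + k) (s≤s z≤n)))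
      (subst (λ c → Framed (proj₂ c) × cfLength c + 2 ≡ 10)
        (sym (Φ₃-unfold z ε h₁ (cong opposite (hε 2 (s≤s (s≤s z≤n)))) (hε 3 (s≤s (s≤s z≤n)))))
        (seed-Φ₃-framed (+ 0) (hz 2 (s≤s z≤n)) (hz 3 (s≤s z≤n))))

  lengths-alternating : z 1 ≡ 2 → (∀ j → 2 ≤ j → ε j ≡ altSign j) → ∀ n → 3 ≤ n →
    ℓ z ε n ≡ 5 * 2 ^ (n ∸ 2) ∸ 2
  lengths-alternating h₁ hε 1 (s≤s ())
  lengths-alternating h₁ hε 2 (s≤s (s≤s ()))
  lengths-alternating h₁ hε (suc (suc (suc k))) _ =
    +2⇒∸2 (trans (proj₂ (framed-from-Φ₃ h₁ hε k)) (arith (2 ^ k)))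
    where
    arith : ∀ y → y * 10 ≡ 5 * (2 * y)
    arith = solve-∀

corollary2p4 : (z : ℕ → ℕ) (ε : ℕ → Sign) →
    (∀ j → 1 ≤ j → 1 < z j) →
    ((2 < z 1 → ∀ n → 1 ≤ n → ℓ z ε n ≡ 3 * 2 ^ (n ∸ 1) ∸ 2)
    × (z 1 ≡ 2 → (∀ j → 2 ≤ j → ε j ≡ Sign.+) → ∀ n → 3 ≤ n → ℓ z ε n ≡ 5 * 2 ^ (n ∸ 2))
    × (z 1 ≡ 2 → (∀ j → 2 ≤ j → ε j ≡ altSign j) → ∀ n → 3 ≤ n → ℓ z ε n ≡ 5 * 2 ^ (n ∸ 2) ∸ 2))
corollary2p4 z ε hz = lengths-x₁>2 z ε hz , lengths-all-plus z ε hz , lengths-alternating z ε hz
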